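{- Suppose that every even Gaussian integer $a+ib$ with integers $a>1$, $b>1$ can be written as a sum $p+q$ of two Gaussian primes $p,q$ lying in $Q=\{x+iy : x,y\in\mathbb{Z},\ x>0,\ y>0\}$. Then there are infinitely many rational primes of the form $n^2+1$ with $n$ a positive integer.
   Context: A Gaussian integer is $z=a+ib$ with $a,b\in\mathbb{Z}$, with norm $N(z)=a^2+b^2$. A Gaussian integer $z=a+ib$ is a Gaussian prime if and only if either $a^2+b^2$ is a rational prime, or $ab=0$ and $|a+ib|$ is a rational prime congruent to $3$ modulo $4$. A Gaussian integer $z$ is called even if $N(z)$ is even, equivalently if $a+b$ is even. -}

module Defs where

open import Data.Nat as ℕ using (ℕ; _%_)
open import Data.Nat.Primality using (Prime)
open import Data.Integer as ℤ using (ℤ; ∣_∣; +_; _>_)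
open import Data.Product using (_×_; _,_; Σ; ∃)
open import Data.Sum using (_⊎_)
open import Relation.Binary.PropositionalEquality using (_≡_)

GaussInt : Set
GaussInt = ℤ × ℤ

re im : GaussInt → ℤ
re (a , _) = a
im (_ , b) = b

norm : GaussInt → ℕ
norm (a , b) = ∣ a ∣ ℕ.* ∣ a ∣ ℕ.+ ∣ b ∣ ℕ.* ∣ b ∣

_+ᵍ_ : GaussInt → GaussInt → GaussInt
(a , b) +ᵍ (c , d) = (a ℤ.+ c , b ℤ.+ d)

-- Gaussian prime, exactly as in the context:
-- either a²+b² is a rational prime, or ab = 0 and |a+ib| is a rational
-- prime congruent to 3 mod 4.  When ab = 0, |a+ib| = |a| + |b|.
GaussianPrime : GaussInt → Set
GaussianPrime (a , b) =
  Prime (norm (a , b))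
  ⊎ ((a ℤ.* b ≡ + 0) × Prime (∣ a ∣ ℕ.+ ∣ b ∣) × ((∣ a ∣ ℕ.+ ∣ b ∣) % 4 ≡ 3))

Even : GaussInt → Set
Even z = norm z % 2 ≡ 0

InQ : GaussInt → Set
InQ (x , y) = (x > + 0) × (y > + 0)

{-# OPTIONS --safe #-}
-- Apply the hypothesis to 2 + 2(m+1)i.  Summands in the open first quadrant
-- have real parts adding up to 2, so both are of the form 1 + iy, and the
-- imaginary parts add up to 2(m+1), so one of them, say y, is at least m + 1.
-- A Gaussian prime 1 + iy off the axes has prime norm y² + 1.
module Submission where

open import Defs
open import Data.Nat using (ℕ; _≥_; _*_; _+_; _≤_; suc; zero; z≤n; s≤s; _%_; _≤?_)
open import Data.Nat.Primality using (Prime)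
open import Data.Integer as ℤ using (ℤ; +_; _>_; +<+)
open import Data.Product using (_×_; _,_; Σ; ∃₂)
open import Data.Sum using (_⊎_; inj₁; inj₂)
open import Relation.Nullary using (yes; no; contradiction)
open import Relation.Binary.PropositionalEquality
  using (_≡_; _≢_; refl; sym; trans; cong; subst)
import Data.Nat.Properties as ℕ
import Data.Integer.Properties as ℤ
open import Data.Nat.DivMod using (m*n%n≡0)
open import Data.Nat.Solver using (module +-*-Solver)

norm-double : ∀ i j → norm (+ (2 * i) , + (2 * j)) ≡ 2 * (i * i + j * j) * 2
norm-double = solve 2 (λ i j →
    (con 2 :* i) :* (con 2 :* i) :+ (con 2 :* j) :* (con 2 :* j)
  := con 2 :* (i :* i :+ j :* j) :* con 2) refl
  where open +-*-Solver

Even-double : ∀ i j → Even (+ (2 * i) , + (2 * j))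
Even-double i j = trans (cong (_% 2) (norm-double i j)) (m*n%n≡0 (2 * (i * i + j * j)) 2)

norm-1+i : ∀ n → norm (+ 1 , + n) ≡ n * n + 1
norm-1+i n = ℕ.+-comm 1 (n * n)

GaussianPrime-offAxis⇒Prime-norm : ∀ a b → a ℤ.* b ≢ + 0 →
  GaussianPrime (a , b) → Prime (norm (a , b))
GaussianPrime-offAxis⇒Prime-norm _ _ _    (inj₁ norm-prime)     = norm-prime
GaussianPrime-offAxis⇒Prime-norm _ _ ab≢0 (inj₂ (ab≡0 , _ , _)) = contradiction ab≡0 ab≢0

GaussianPrime-1+i⇒Prime : ∀ y → GaussianPrime (+ 1 , + suc y) → Prime (suc y * suc y + 1)
GaussianPrime-1+i⇒Prime y 1+iy-prime =
  subst Prime (norm-1+i (suc y)) (GaussianPrime-offAxis⇒Prime-norm (+ 1) (+ suc y) (λ ()) 1+iy-prime)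

InQ⇒positiveParts : ∀ {z} → InQ z → ∃₂ λ x y → z ≡ (+ suc x , + suc y)
InQ⇒positiveParts {+ suc x , + suc y} _ = x , y , refl
InQ⇒positiveParts {+ zero , _} (+<+ () , _)
InQ⇒positiveParts {+ suc _ , + zero} (_ , +<+ ())

1+m+1+n≡2⇒m≡0×n≡0 : ∀ m n → suc m + suc n ≡ 2 → m ≡ 0 × n ≡ 0
1+m+1+n≡2⇒m≡0×n≡0 zero    zero    _  = refl , refl
1+m+1+n≡2⇒m≡0×n≡0 zero    (suc _) ()
1+m+1+n≡2⇒m≡0×n≡0 (suc m) n       eq = contradiction (ℕ.suc-injective (ℕ.suc-injective eq)) (ℕ.m+1+n≢0 m)

Q-summands-of-2+ib : ∀ {p q b} → InQ p → InQ q → p +ᵍ q ≡ (+ 2 , + b) →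
  ∃₂ λ y y' → p ≡ (+ 1 , + suc y) × q ≡ (+ 1 , + suc y') × suc y + suc y' ≡ b
Q-summands-of-2+ib p∈Q q∈Q p+q≡2+ib
  with InQ⇒positiveParts p∈Q | InQ⇒positiveParts q∈Q
... | x , y , refl | x' , y' , refl
  with 1+m+1+n≡2⇒m≡0×n≡0 x x' (ℤ.+-injective (cong re p+q≡2+ib))
... | refl , refl = y , y' , refl , refl , ℤ.+-injective (cong im p+q≡2+ib)

m+n≡2k⇒k≤m⊎k≤n : ∀ {m n} k → m + n ≡ 2 * k → k ≤ m ⊎ k ≤ n
m+n≡2k⇒k≤m⊎k≤n {m} {n} k m+n≡2k with k ≤? m | k ≤? n
... | yes k≤m | _       = inj₁ k≤m
... | no _    | yes k≤n = inj₂ k≤n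
... | no k≰m  | no k≰n  = contradiction m+n≡2k (ℕ.<⇒≢ (begin-strict
  m + n       <⟨ ℕ.+-mono-< (ℕ.≰⇒> k≰m) (ℕ.≰⇒> k≰n) ⟩
  k + k       ≡⟨ cong (λ j → k + j) (sym (ℕ.+-identityʳ k)) ⟩
  2 * k       ∎))
  where open ℕ.≤-Reasoning

mainTheorem1 :
    ((a b : ℤ) → a > + 1 → b > + 1 → Even (a , b) →
      Σ GaussInt λ p → Σ GaussInt λ q →
        GaussianPrime p × GaussianPrime q × InQ p × InQ q × (p +ᵍ q ≡ (a , b))) →
    (m : ℕ) → Σ ℕ λ n → n ≥ m × n ≥ 1 × Prime (n * n + 1)
mainTheorem1 goldbach m
  with goldbach (+ 2) (+ (2 * suc m)) (+<+ ℕ.≤-refl)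
         (+<+ (ℕ.*-monoʳ-≤ 2 (s≤s z≤n))) (Even-double 1 (suc m))
... | p , q , p-prime , q-prime , p∈Q , q∈Q , p+q≡
  with Q-summands-of-2+ib p∈Q q∈Q p+q≡
... | y , y' , refl , refl , y+y'≡
  with m+n≡2k⇒k≤m⊎k≤n (suc m) y+y'≡
... | inj₁ 1+m≤1+y  = suc y  , ℕ.m≤n⇒m≤1+n (ℕ.≤-pred 1+m≤1+y)  , s≤s z≤n , GaussianPrime-1+i⇒Prime y  p-prime
... | inj₂ 1+m≤1+y' = suc y' , ℕ.m≤n⇒m≤1+n (ℕ.≤-pred 1+m≤1+y') , s≤s z≤n , GaussianPrime-1+i⇒Prime y' q-prime
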